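{- Let $i,j\in\mathbb{Z}$, $x\in\mathsf{Set}_{i+1}$, $y\in\mathsf{Set}_i$, $a\in\mathbb{A}_j$ and $u\in\mathsf{Set}_j$. Then: (1) $(y\mathbin{\tilde\in}x)[a\mapsto u]=y[a\mapsto u]\mathbin{\tilde\in}x[a\mapsto u]$; (2) if $j=i+1$ then $(y\mathbin{\tilde\in}a)[a\mapsto u]=y[a\mapsto u]\mathbin{\tilde\in}u$; (3) if $b\in\mathbb{A}_{i+1}$ is an atom distinct from $a$ then $(y\mathbin{\tilde\in}b)[a\mapsto u]=y[a\mapsto u]\mathbin{\tilde\in}b$.
   Context: Atoms: for each $i\in\mathbb{Z}$ fix a countably infinite set $\mathbb{A}_i$ of atoms, pairwise disjoint, $\mathbb{A}=\bigcup_i\mathbb{A}_i$, $\mathrm{level}(a)=i$ iff $a\in\mathbb{A}_i$. Permutations are finitely-supported level-preserving bijections of $\mathbb{A}$; $\mathrm{supp}(x)$ is the least finite set of atoms such that every permutation fixing it pointwise fixes $x$, and $a\#x$ means $a\notin\mathrm{supp}(x)$. $[a]X$ is nominal atoms-abstraction (binding $a$ in $X$): $[a]X=[b]((b\ a)\cdot X)$ when $b\#X$. Internal syntax: $\mathsf{Pred}$ and $\mathsf{Set}_i$ ($i\in\mathbb{Z}$) are defined inductively: $\mathsf{atm}(a)\in\mathsf{Set}_i$ for $a\in\mathbb{A}_i$; $\mathsf{and}(\mathcal X)\in\mathsf{Pred}$ for finite $\mathcal X\subseteq\mathsf{Pred}$; $\mathsf{neg}(X)$; $\mathsf{all}([a]X)$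 for $a\in\mathbb{A}$; $\mathsf{elt}(x,a)\in\mathsf{Pred}$ for $a\in\mathbb{A}_{i+1}$, $x\in\mathsf{Set}_i$; $\mathsf{st}([a]X)\in\mathsf{Set}_i$ for $a\in\mathbb{A}_{i-1}$, $X\in\mathsf{Pred}$ (an internal comprehension). For an internal comprehension $x\in\mathsf{Set}_{i}$ and $c\in\mathbb{A}_{i-1}$ with $c\#x$, $x@c$ is the unique $X$ with $x=\mathsf{st}([c]X)$. Sigma-action: for $a\in\mathbb{A}_i$, $x\in\mathsf{Set}_i$, the well-defined operation $Z[a\mapsto x]$, $z[a\mapsto x]$ is given by (with $b,c$ atoms distinct from $a$): $\mathsf{and}(\mathcal X)[a\mapsto x]=\mathsf{and}(\{X[a\mapsto x]\mid X\in\mathcal X\})$; $\mathsf{neg}(X)[a\mapsto x]=\mathsf{neg}(X[a\mapsto x])$; $\mathsf{all}([b]X)[a\mapsto x]=\mathsf{all}([b](X[a\mapsto x]))$ if $b\#x$; $\mathsf{elt}(y,a)[a\mapsto\mathsf{atm}(n)]=\mathsf{elt}(y[a\mapsto\mathsf{atm}(n)],n)$ for any $n\in\mathbb{A}_i$; $\mathsf{elt}(y,a)[a\mapsto\mathsf{st}([a']X')]=X'[a'\mapsto y[a\mapsto\mathsf{st}([a']X')]]$ for fresh $a'\in\mathbb{A}_{i-1}$; $\mathsf{elt}(y,b)[a\mapsto x]=\mathsf{elt}(y[a\mapsto x],b)$; $\mathsf{atm}(a)[a\mapsto x]=x$; $\mathsf{atm}(b)[a\mapsto x]=\mathsf{atm}(b)$;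 $\mathsf{st}([c]X)[a\mapsto x]=\mathsf{st}([c](X[a\mapsto x]))$ if $c\#x$. Internal membership: for $x\in\mathsf{Set}_{i}$ and $y\in\mathsf{Set}_{i-1}$, $y\mathbin{\tilde\in}x=(x@b)[b\mapsto y]$ for a fresh $b\in\mathbb{A}_{i-1}$ (with $b\#x,y$) if $x$ is an internal comprehension, and $y\mathbin{\tilde\in}\mathsf{atm}(a)=\mathsf{elt}(y,a)$; for an atom $a\in\mathbb{A}_i$ also $y\mathbin{\tilde\in}a=\mathsf{elt}(y,a)$. -}

module Defs where

-- Internal syntax of the paper, rendered with de Bruijn indices for bound
-- atoms (so nominal atoms-abstraction / alpha-equivalence is built in) and
-- named free atoms  (level , name) ∈ ℤ × ℕ  (each level has countably many).

open import Data.Nat using (ℕ; zero; suc; _⊔_; _+_) renaming (_≟_ to _≟ℕ_)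
open import Data.Integer using (ℤ; ∣_∣) renaming (suc to sucℤ; _≟_ to _≟ℤ_)
open import Data.List using (List; []; _∷_)
open import Data.List.Relation.Unary.All using (All)
open import Data.List.Relation.Unary.Any using (Any)
open import Data.Product using (_×_; _,_)
open import Relation.Nullary using (yes; no)
open import Relation.Binary.PropositionalEquality using (_≡_)

Atom : Set
Atom = ℤ × ℕ

data Var : Set where
  fr : ℤ → ℕ → Var
  bv : ℕ → Var

-- Raw terms.  all k X  is  all([a]X) with a ∈ 𝔸_k bound;
-- st k X  is  st([c]X) with c ∈ 𝔸_k bound (a comprehension of level k+1).
mutual
  data Pred : Set where
    and : List Pred → Pred
    neg : Pred → Pred
    all : ℤ → Pred → Pred
    elt : SetT → Var → Pred

  data SetT : Set where
    atm : Var → SetT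
    st  : ℤ → Pred → SetT

data _∋_∶_ : List ℤ → ℕ → ℤ → Set where
  ze : ∀ {Γ k} → (k ∷ Γ) ∋ zero ∶ k
  su : ∀ {Γ k m j} → Γ ∋ m ∶ j → (k ∷ Γ) ∋ suc m ∶ j

data WTV (Γ : List ℤ) : Var → ℤ → Set where
  fr : ∀ j n → WTV Γ (fr j n) j
  bv : ∀ {m j} → Γ ∋ m ∶ j → WTV Γ (bv m) j

mutual
  data WTP (Γ : List ℤ) : Pred → Set where
    and : ∀ {xs} → All (WTP Γ) xs → WTP Γ (and xs)
    neg : ∀ {X} → WTP Γ X → WTP Γ (neg X)
    all : ∀ {k X} → WTP (k ∷ Γ) X → WTP Γ (all k X)
    elt : ∀ {x v i} → WTS Γ x i → WTV Γ v (sucℤ i) → WTP Γ (elt x v)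

  data WTS (Γ : List ℤ) : SetT → ℤ → Set where
    atm : ∀ {v i} → WTV Γ v i → WTS Γ (atm v) i
    st  : ∀ {k X i} → WTP (k ∷ Γ) X → i ≡ sucℤ k → WTS Γ (st k X) i

-- x ∈ Set_i  ⇔  WTS [] x i ;   X ∈ Pred  ⇔  WTP [] X.

-- Equality of terms: syntactic, except that and(𝒳) takes a finite SET 𝒳,
-- so the argument lists of 'and' are compared as sets (recursively).

infix 4 _≈P_ _≈S_

mutual
  data _≈P_ : Pred → Pred → Set where
    and≈ : ∀ {xs ys} → All (λ X → Any (X ≈P_) ys) xs →
           All (λ Y → Any (_≈P Y) xs) ys → and xs ≈P and ys
    neg≈ : ∀ {X Y} → X ≈P Y → neg X ≈P neg Y
    all≈ : ∀ {X Y} k → X ≈P Y → all k X ≈P all k Y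
    elt≈ : ∀ {x y} v → x ≈S y → elt x v ≈P elt y v

  data _≈S_ : SetT → SetT → Set where
    atm≈ : ∀ v → atm v ≈S atm v
    st≈  : ∀ {X Y} k → X ≈P Y → st k X ≈S st k Y

shiftV : ℕ → Var → Var
shiftV c (fr j n) = fr j n
shiftV zero (bv m) = bv (suc m)
shiftV (suc c) (bv zero) = bv zero
shiftV (suc c) (bv (suc m)) with shiftV c (bv m)
... | bv m' = bv (suc m')
... | fr j n = fr j n

mutual
  shiftP : ℕ → Pred → Pred
  shiftP c (and xs) = and (shiftL c xs)
  shiftP c (neg X) = neg (shiftP c X)
  shiftP c (all k X) = all k (shiftP (suc c) X)
  shiftP c (elt y w) = elt (shiftS c y) (shiftV c w)

  shiftL : ℕ → List Pred → List Pred
  shiftL c [] = []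
  shiftL c (X ∷ xs) = shiftP c X ∷ shiftL c xs

  shiftS : ℕ → SetT → SetT
  shiftS c (atm w) = atm (shiftV c w)
  shiftS c (st k X) = st k (shiftP (suc c) X)

-- The variable being substituted: a free atom, or a bound index (which is
-- removed, higher indices decremented).

data Tgt : Set where
  tfr : ℤ → ℕ → Tgt
  tbv : ℕ → Tgt

up : Tgt → Tgt
up (tfr j n) = tfr j n
up (tbv k) = tbv (suc k)

data Look : Set where
  hit  : Look
  miss : Var → Look

lookBv : ℕ → ℕ → Look
lookBv zero zero = hit
lookBv zero (suc m) = miss (bv m)
lookBv (suc k) zero = miss (bv zero)
lookBv (suc k) (suc m) with lookBv k m
... | hit = hit
... | miss (bv m') = miss (bv (suc m'))
... | miss (fr j n) = miss (fr j n)

look : Tgt → Var → Look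
look (tfr j n) (fr j' n') with j ≟ℤ j' | n ≟ℕ n'
... | yes _ | yes _ = hit
... | _     | _     = miss (fr j' n')
look (tfr j n) (bv m) = miss (bv m)
look (tbv k) (fr j n) = miss (fr j n)
look (tbv k) (bv m) = lookBv k m

-- The clause
--   elt(y,a)[a↦st([a']X')] = X'[a' ↦ y[a↦st([a']X')]]
-- is not structurally recursive; it is computed with a fuel argument
-- counting nested uses of this clause (each such use lowers the level of the
-- substituted atom by one).  σP/σS below supply sufficient fuel.

mutual
  subP : ℕ → Tgt → SetT → Pred → Pred
  subP n t s (and xs) = and (subL n t s xs)
  subP n t s (neg X) = neg (subP n t s X)
  subP n t s (all k X) = all k (subP n (up t) (shiftS zero s) X)
  subP n t s (elt y w) = eltCase n s (subS n t s y) (look t w)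

  subL : ℕ → Tgt → SetT → List Pred → List Pred
  subL n t s [] = []
  subL n t s (X ∷ xs) = subP n t s X ∷ subL n t s xs

  eltCase : ℕ → SetT → SetT → Look → Pred
  eltCase n s y' (miss w') = elt y' w'
  eltCase n (atm v) y' hit = elt y' v
  eltCase zero (st k X') y' hit = and []   -- out of fuel (never reached by σ)
  eltCase (suc n) (st k X') y' hit = subP n (tbv zero) y' X'

  subS : ℕ → Tgt → SetT → SetT → SetT
  subS n t s (atm w) with look t w
  ... | hit = s
  ... | miss w' = atm w'
  subS n t s (st k X) = st k (subP n (up t) (shiftS zero s) X)

mutual
  lvP : Pred → ℕ
  lvP (and xs) = lvL xs
  lvP (neg X) = lvP X
  lvP (all k X) = ∣ k ∣ ⊔ lvP X
  lvP (elt y w) = lvS y ⊔ lvV w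

  lvL : List Pred → ℕ
  lvL [] = zero
  lvL (X ∷ xs) = lvP X ⊔ lvL xs

  lvS : SetT → ℕ
  lvS (atm w) = lvV w
  lvS (st k X) = ∣ k ∣ ⊔ lvP X

  lvV : Var → ℕ
  lvV (fr j n) = ∣ j ∣
  lvV (bv m) = zero

-- Fuel: nested β-steps go through levels j, j-1, ..., each above the least
-- comprehension-binder level m, so  j - m ≤ ∣j∣ + (max |levels|)  suffices.
fuel : ℤ → ℕ → ℕ
fuel j b = suc (∣ j ∣ + b)

infixl 10 _[_↦_]P _[_↦_]S
infix 6 _∈̃_ _∈̃ₐ_

_[_↦_]P : Pred → Atom → SetT → Pred
X [ (j , n) ↦ u ]P = subP (fuel j (lvP X ⊔ lvS u)) (tfr j n) u X

_[_↦_]S : SetT → Atom → SetT → SetT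
x [ (j , n) ↦ u ]S = subS (fuel j (lvS x ⊔ lvS u)) (tfr j n) u x

-- Freshness: a name larger than every free-atom name occurring.

mutual
  nmP : Pred → ℕ
  nmP (and xs) = nmL xs
  nmP (neg X) = nmP X
  nmP (all k X) = nmP X
  nmP (elt y w) = nmS y ⊔ nmV w

  nmL : List Pred → ℕ
  nmL [] = zero
  nmL (X ∷ xs) = nmP X ⊔ nmL xs

  nmS : SetT → ℕ
  nmS (atm w) = nmV w
  nmS (st k X) = nmP X

  nmV : Var → ℕ
  nmV (fr j n) = n
  nmV (bv m) = zero

-- x @ c for x = st([c]X): the body X with the bound atom named c.
_at_ : SetT → Atom → Pred
st k X at (l , c) = subP zero (tbv zero) (atm (fr l c)) X
atm v at c = and []   -- not a comprehension (unused)

_∈̃_ : SetT → SetT → Pred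
y ∈̃ atm v = elt y v
y ∈̃ st k X = (st k X at b) [ b ↦ y ]P
  where
  b : Atom
  b = k , suc (nmP X ⊔ nmS y)

_∈̃ₐ_ : SetT → Atom → Pred
y ∈̃ₐ (j , n) = elt y (fr j n)

module Submission where

-- The proof has four ingredients.
--  * Syntax: shifting commutes with shifting and with substitution,
--    substituting into a shifted term does nothing, and renaming a bound index
--    to a fresh atom before substituting for that atom is the same as
--    substituting for the index directly.
--  * Typing: well-levelled terms stay well-levelled under shifting and
--    substitution, and substitution does not raise the level bound.
--  * Fuel: on well-levelled terms, any fuel exceeding a bound computed from the
--    target level and the level bound gives the same result.  Hence σ and ∈̃
--    may be computed at any sufficient fuel ('σS-fuel', '∈̃-unfold').
--  * The substitution lemma  X[c↦S₂][t↦S₁] = X[t↦S₁][c↦S₂[t↦S₁]]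
--    ('subst-commP'), proved by induction on a fuel budget, the beta-clause
--    calling the lemma again on the body of the substituted comprehension.
-- Parts (2) and (3) of the lemma unfold one 'elt' clause; part (1) reduces to
-- them when x is an atom, and otherwise is the substitution lemma applied to
-- the unfolded membership  y ∈̃ st k X = X[0↦y].

open import Defs
open import Data.Nat using (ℕ; zero; suc; _+_; _≤_; _<_; z≤n; s≤s; s≤s⁻¹; _⊔_)
  renaming (_≟_ to _≟ℕ_)
open import Data.Nat.Properties
  using (≤-refl; ≤-trans; ≤-total; <-irrefl; m≤m⊔n; m≤n⊔m; ⊔-lub; m⊔n≤o⇒m≤o; m⊔n≤o⇒n≤o;
         +-suc; +-comm; m≤n+m; m≤m+n; m≤n⇒m≤1+n; +-monoʳ-≤; +-monoˡ-≤)
open import Data.List using (List; []; _∷_)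
open import Data.List.Relation.Unary.All using (All; []; _∷_)
import Data.List.Relation.Unary.All as All
import Data.List.Relation.Unary.Any as Any
open import Data.Integer using (ℤ; +_; -[1+_]; ∣_∣) renaming (suc to sucℤ; _≟_ to _≟ℤ_)
import Data.Integer as ℤ
import Data.Integer.Properties as ℤ
open import Data.Product using (Σ; _×_; _,_; proj₁; proj₂)
import Data.Product
open import Data.Sum using (inj₁; inj₂)
open import Data.Empty using (⊥-elim)
open import Data.Unit using (⊤; tt)
open import Relation.Nullary using (yes; no; ¬_)
open import Relation.Binary.PropositionalEquality
open ≡-Reasoning

shiftIdx : ℕ → ℕ → ℕ
shiftIdx zero m = suc m
shiftIdx (suc c) zero = zero
shiftIdx (suc c) (suc m) = suc (shiftIdx c m)

shiftV-bv : ∀ c m → shiftV c (bv m) ≡ bv (shiftIdx c m)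
shiftV-bv zero m = refl
shiftV-bv (suc c) zero = refl
shiftV-bv (suc c) (suc m) with shiftV c (bv m) | shiftV-bv c m
... | .(bv (shiftIdx c m)) | refl = refl

shiftIdx-below : ∀ {c m} → m < c → shiftIdx c m ≡ m
shiftIdx-below {suc c} {zero} _ = refl
shiftIdx-below {suc c} {suc m} (s≤s m<c) = cong suc (shiftIdx-below m<c)

shiftIdx-above : ∀ {c m} → c ≤ m → shiftIdx c m ≡ suc m
shiftIdx-above {zero} _ = refl
shiftIdx-above {suc c} {suc m} (s≤s c≤m) = cong suc (shiftIdx-above c≤m)

shiftIdx-comm : ∀ {c d} → c ≤ d → ∀ m → shiftIdx (suc d) (shiftIdx c m) ≡ shiftIdx c (shiftIdx d m)
shiftIdx-comm {zero} c≤d m = refl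
shiftIdx-comm {suc c} {suc d} c≤d zero = refl
shiftIdx-comm {suc c} {suc d} (s≤s c≤d) (suc m) = cong suc (shiftIdx-comm c≤d m)

lookBv-self : ∀ k → lookBv k k ≡ hit
lookBv-self zero = refl
lookBv-self (suc k) with lookBv k k | lookBv-self k
... | .hit | refl = refl

lookBv-shiftIdx : ∀ k m → lookBv k (shiftIdx k m) ≡ miss (bv m)
lookBv-shiftIdx zero m = refl
lookBv-shiftIdx (suc k) zero = refl
lookBv-shiftIdx (suc k) (suc m) with lookBv k (shiftIdx k m) | lookBv-shiftIdx k m
... | .(miss (bv m)) | refl = refl

data IdxView (k : ℕ) : ℕ → Set where
  at-k  : IdxView k k
  off-k : ∀ m → IdxView k (shiftIdx k m)

idxView : ∀ k m → IdxView k m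
idxView zero zero = at-k
idxView zero (suc m) = off-k m
idxView (suc k) zero = off-k zero
idxView (suc k) (suc m) with idxView k m
... | at-k = at-k
... | off-k m' = off-k (suc m')

look-free-hit : ∀ {j n j' n'} → j ≡ j' → n ≡ n' → look (tfr j n) (fr j' n') ≡ hit
look-free-hit {j} {n} refl refl with j ≟ℤ j | n ≟ℕ n
... | yes _ | yes _ = refl
... | yes _ | no n≢n = ⊥-elim (n≢n refl)
... | no j≢j | _ = ⊥-elim (j≢j refl)

look-free-miss : ∀ {j n j' n'} → (j , n) ≢ (j' , n') → look (tfr j n) (fr j' n') ≡ miss (fr j' n')
look-free-miss {j} {n} {j'} {n'} ne with j ≟ℤ j' | n ≟ℕ n'
... | yes refl | yes refl = ⊥-elim (ne refl)
... | yes _ | no _ = refl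
... | no _ | _ = refl

look-free-self : ∀ j n → look (tfr j n) (fr j n) ≡ hit
look-free-self j n = look-free-hit refl refl

data FreeLook (j : ℤ) (n : ℕ) (j' : ℤ) (n' : ℕ) : Set where
  same  : j ≡ j' → n ≡ n' → FreeLook j n j' n'
  other : (j , n) ≢ (j' , n') → FreeLook j n j' n'

freeLook : ∀ j n j' n' → FreeLook j n j' n'
freeLook j n j' n' with j ≟ℤ j' | n ≟ℕ n'
... | yes j≡ | yes n≡ = same j≡ n≡
... | yes _ | no n≢ = other (λ e → n≢ (cong proj₂ e))
... | no j≢ | _ = other (λ e → j≢ (cong proj₁ e))

shiftV-comm : ∀ {c d} → c ≤ d → ∀ v → shiftV (suc d) (shiftV c v) ≡ shiftV c (shiftV d v)
shiftV-comm c≤d (fr j n) = refl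
shiftV-comm {c} {d} c≤d (bv m)
  rewrite shiftV-bv c m | shiftV-bv d m | shiftV-bv (suc d) (shiftIdx c m) | shiftV-bv c (shiftIdx d m)
  = cong bv (shiftIdx-comm c≤d m)

mutual
  shiftP-comm : ∀ {c d} → c ≤ d → ∀ X → shiftP (suc d) (shiftP c X) ≡ shiftP c (shiftP d X)
  shiftP-comm c≤d (and xs) = cong and (shiftL-comm c≤d xs)
  shiftP-comm c≤d (neg X) = cong neg (shiftP-comm c≤d X)
  shiftP-comm c≤d (all k X) = cong (all k) (shiftP-comm (s≤s c≤d) X)
  shiftP-comm c≤d (elt y w) = cong₂ elt (shiftS-comm c≤d y) (shiftV-comm c≤d w)

  shiftL-comm : ∀ {c d} → c ≤ d → ∀ xs → shiftL (suc d) (shiftL c xs) ≡ shiftL c (shiftL d xs)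
  shiftL-comm c≤d [] = refl
  shiftL-comm c≤d (X ∷ xs) = cong₂ _∷_ (shiftP-comm c≤d X) (shiftL-comm c≤d xs)

  shiftS-comm : ∀ {c d} → c ≤ d → ∀ s → shiftS (suc d) (shiftS c s) ≡ shiftS c (shiftS d s)
  shiftS-comm c≤d (atm w) = cong atm (shiftV-comm c≤d w)
  shiftS-comm c≤d (st k X) = cong (st k) (shiftP-comm (s≤s c≤d) X)

shiftS-comm₀ : ∀ d s → shiftS (suc d) (shiftS zero s) ≡ shiftS zero (shiftS d s)
shiftS-comm₀ d = shiftS-comm z≤n

-- ShiftTgt t c t′ c′ : shifting at c after substituting for t agrees with
-- substituting for t′ after shifting at c′ (the target moves past the cutoff).
data ShiftTgt : Tgt → ℕ → Tgt → ℕ → Set where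
  sh-free  : ∀ {j n c} → ShiftTgt (tfr j n) c (tfr j n) c
  sh-below : ∀ {k c} → k ≤ c → ShiftTgt (tbv k) c (tbv k) (suc c)
  sh-above : ∀ {k c} → c ≤ k → ShiftTgt (tbv k) c (tbv (suc k)) c

ShiftTgt-up : ∀ {t c t′ c′} → ShiftTgt t c t′ c′ → ShiftTgt (up t) (suc c) (up t′) (suc c′)
ShiftTgt-up sh-free = sh-free
ShiftTgt-up (sh-below k≤c) = sh-below (s≤s k≤c)
ShiftTgt-up (sh-above c≤k) = sh-above (s≤s c≤k)

ShiftTgt-zero : ∀ t → ShiftTgt t zero (up t) zero
ShiftTgt-zero (tfr j n) = sh-free
ShiftTgt-zero (tbv k) = sh-above z≤n

mapLook : (Var → Var) → Look → Look
mapLook f hit = hit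
mapLook f (miss w) = miss (f w)

look-shift : ∀ {t c t′ c′} → ShiftTgt t c t′ c′ → ∀ v →
             look t′ (shiftV c′ v) ≡ mapLook (shiftV c) (look t v)
look-shift {tfr j n} sh-free (fr j' n') with freeLook j n j' n'
... | same refl refl rewrite look-free-self j n = refl
... | other ne rewrite look-free-miss ne = refl
look-shift {tfr j n} {c} sh-free (bv m) rewrite shiftV-bv c m = refl
look-shift (sh-below k≤c) (fr j n) = refl
look-shift (sh-above c≤k) (fr j n) = refl
look-shift {tbv k} {c} (sh-below k≤c) (bv m) with idxView k m
... | at-k rewrite shiftV-bv (suc c) k | shiftIdx-below {suc c} {k} (s≤s k≤c) | lookBv-self k = refl
... | off-k m' rewrite shiftV-bv (suc c) (shiftIdx k m') | lookBv-shiftIdx k m' | shiftIdx-comm k≤c m'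
                    | lookBv-shiftIdx k (shiftIdx c m') | shiftV-bv c m' = refl
look-shift {tbv k} {c} (sh-above c≤k) (bv m) with idxView k m
... | at-k rewrite shiftV-bv c k | shiftIdx-above c≤k | lookBv-self k = refl
... | off-k m' rewrite shiftV-bv c (shiftIdx k m') | lookBv-shiftIdx k m' | sym (shiftIdx-comm c≤k m')
                    | lookBv-shiftIdx (suc k) (shiftIdx c m') | shiftV-bv c m' = refl

mutual
  shift-substP : ∀ {t c t′ c′} → ShiftTgt t c t′ c′ → ∀ n S X →
                 shiftP c (subP n t S X) ≡ subP n t′ (shiftS c S) (shiftP c′ X)
  shift-substP p n S (and xs) = cong and (shift-substL p n S xs)
  shift-substP p n S (neg X) = cong neg (shift-substP p n S X)
  shift-substP p n S (all k X) = cong (all k) (shift-subst-under p n S X)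
  shift-substP {t} p n S (elt y w) rewrite look-shift p w | sym (shift-substS p n S y) =
    shift-eltCase n S (subS n t S y) (look t w)

  shift-substL : ∀ {t c t′ c′} → ShiftTgt t c t′ c′ → ∀ n S xs →
                 shiftL c (subL n t S xs) ≡ subL n t′ (shiftS c S) (shiftL c′ xs)
  shift-substL p n S [] = refl
  shift-substL p n S (X ∷ xs) = cong₂ _∷_ (shift-substP p n S X) (shift-substL p n S xs)

  shift-substS : ∀ {t c t′ c′} → ShiftTgt t c t′ c′ → ∀ n S s →
                 shiftS c (subS n t S s) ≡ subS n t′ (shiftS c S) (shiftS c′ s)
  shift-substS {t} p n S (atm w) rewrite look-shift p w with look t w
  ... | hit = refl
  ... | miss w' = refl
  shift-substS p n S (st k X) = cong (st k) (shift-subst-under p n S X)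

  shift-subst-under : ∀ {t c t′ c′} → ShiftTgt t c t′ c′ → ∀ n S X →
                      shiftP (suc c) (subP n (up t) (shiftS zero S) X)
                        ≡ subP n (up t′) (shiftS zero (shiftS c S)) (shiftP (suc c′) X)
  shift-subst-under {c = c} {t′} {c′} p n S X =
    trans (shift-substP (ShiftTgt-up p) n (shiftS zero S) X)
          (cong (λ S′ → subP n (up t′) S′ (shiftP (suc c′) X)) (shiftS-comm₀ c S))

  shift-eltCase : ∀ {c} n S y L →
                  shiftP c (eltCase n S y L) ≡ eltCase n (shiftS c S) (shiftS c y) (mapLook (shiftV c) L)
  shift-eltCase n S y (miss w) = refl
  shift-eltCase n (atm v) y hit = refl
  shift-eltCase zero (st k X) y hit = refl
  shift-eltCase (suc n) (st k X) y hit = shift-substP (sh-below z≤n) n y X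

look-shifted : ∀ c v → look (tbv c) (shiftV c v) ≡ miss v
look-shifted c (fr j n) = refl
look-shifted c (bv m) rewrite shiftV-bv c m = lookBv-shiftIdx c m

mutual
  subst-shiftedP : ∀ n c S X → subP n (tbv c) S (shiftP c X) ≡ X
  subst-shiftedP n c S (and xs) = cong and (subst-shiftedL n c S xs)
  subst-shiftedP n c S (neg X) = cong neg (subst-shiftedP n c S X)
  subst-shiftedP n c S (all k X) = cong (all k) (subst-shiftedP n (suc c) (shiftS zero S) X)
  subst-shiftedP n c S (elt y w) rewrite look-shifted c w | subst-shiftedS n c S y = refl

  subst-shiftedL : ∀ n c S xs → subL n (tbv c) S (shiftL c xs) ≡ xs
  subst-shiftedL n c S [] = refl
  subst-shiftedL n c S (X ∷ xs) = cong₂ _∷_ (subst-shiftedP n c S X) (subst-shiftedL n c S xs)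

  subst-shiftedS : ∀ n c S s → subS n (tbv c) S (shiftS c s) ≡ s
  subst-shiftedS n c S (atm w) rewrite look-shifted c w = refl
  subst-shiftedS n c S (st k X) = cong (st k) (subst-shiftedP n (suc c) (shiftS zero S) X)

-- Instantiating a bound index by a fresh atom and then substituting for
-- that atom is substitution for the index (atoms-abstraction is
-- independent of the fresh name, the point of  x@c  in the paper).

look-fresh : ∀ {j b} j' n' → n' < b → look (tfr j b) (fr j' n') ≡ miss (fr j' n')
look-fresh j' n' n'<b = look-free-miss (λ e → <-irrefl (sym (cong proj₂ e)) n'<b)

<-⊔ˡ : ∀ {a b c} → a ⊔ b < c → a < c
<-⊔ˡ {a} {b} p = ≤-trans (s≤s (m≤m⊔n a b)) p

<-⊔ʳ : ∀ {a b c} → a ⊔ b < c → b < c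
<-⊔ʳ {a} {b} p = ≤-trans (s≤s (m≤n⊔m a b)) p

mutual
  subst-renameP : ∀ n m c j b y X → nmP X < b →
                  subP n (tfr j b) y (subP m (tbv c) (atm (fr j b)) X) ≡ subP n (tbv c) y X
  subst-renameP n m c j b y (and xs) fresh = cong and (subst-renameL n m c j b y xs fresh)
  subst-renameP n m c j b y (neg X) fresh = cong neg (subst-renameP n m c j b y X fresh)
  subst-renameP n m c j b y (all k X) fresh = cong (all k) (subst-renameP n m (suc c) j b (shiftS zero y) X fresh)
  subst-renameP n m c j b y (elt z (fr j' n')) fresh
    rewrite look-fresh {j} {b} j' n' (<-⊔ʳ {nmS z} fresh) | subst-renameS n m c j b y z (<-⊔ˡ fresh) = refl
  subst-renameP n m c j b y (elt z (bv m')) fresh with idxView c m'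
  ... | at-k rewrite lookBv-self c | look-free-self j b | subst-renameS n m c j b y z (<-⊔ˡ fresh) = refl
  ... | off-k m'' rewrite lookBv-shiftIdx c m'' | subst-renameS n m c j b y z (<-⊔ˡ fresh) = refl

  subst-renameL : ∀ n m c j b y xs → nmL xs < b →
                  subL n (tfr j b) y (subL m (tbv c) (atm (fr j b)) xs) ≡ subL n (tbv c) y xs
  subst-renameL n m c j b y [] fresh = refl
  subst-renameL n m c j b y (X ∷ xs) fresh =
    cong₂ _∷_ (subst-renameP n m c j b y X (<-⊔ˡ fresh)) (subst-renameL n m c j b y xs (<-⊔ʳ {nmP X} fresh))

  subst-renameS : ∀ n m c j b y s → nmS s < b →
                  subS n (tfr j b) y (subS m (tbv c) (atm (fr j b)) s) ≡ subS n (tbv c) y s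
  subst-renameS n m c j b y (atm (fr j' n')) fresh rewrite look-fresh {j} {b} j' n' fresh = refl
  subst-renameS n m c j b y (atm (bv m')) fresh with idxView c m'
  ... | at-k rewrite lookBv-self c | look-free-self j b = refl
  ... | off-k m'' rewrite lookBv-shiftIdx c m'' = refl
  subst-renameS n m c j b y (st k X) fresh = cong (st k) (subst-renameP n m (suc c) j b (shiftS zero y) X fresh)

and-refl : ∀ {xs} → All (λ X → X ≈P X) xs → and xs ≈P and xs
and-refl rs = and≈ (All.tabulate λ X∈ → Any.map (λ { refl → All.lookup rs X∈ }) X∈)
                   (All.tabulate λ X∈ → Any.map (λ { refl → All.lookup rs X∈ }) X∈)

mutual
  ≈P-refl : ∀ X → X ≈P X
  ≈P-refl (and xs) = and-refl (≈L-refl xs)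
  ≈P-refl (neg X) = neg≈ (≈P-refl X)
  ≈P-refl (all k X) = all≈ k (≈P-refl X)
  ≈P-refl (elt y v) = elt≈ v (≈S-refl y)

  ≈L-refl : ∀ xs → All (λ X → X ≈P X) xs
  ≈L-refl [] = []
  ≈L-refl (X ∷ xs) = ≈P-refl X ∷ ≈L-refl xs

  ≈S-refl : ∀ s → s ≈S s
  ≈S-refl (atm v) = atm≈ v
  ≈S-refl (st k X) = st≈ k (≈P-refl X)

≡⇒≈P : ∀ {X Y} → X ≡ Y → X ≈P Y
≡⇒≈P {X} refl = ≈P-refl X

-- A context assigns a level to every de Bruijn index; TyP/TyS are
-- the paper's typing (WTP/WTS) with the list of bound levels extended to a
-- total assignment, which makes shifting and substitution easy to type.

Ctx : Set
Ctx = ℕ → ℤ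

_∷c_ : ℤ → Ctx → Ctx
(k ∷c ρ) zero = k
(k ∷c ρ) (suc m) = ρ m

data TyV (ρ : Ctx) : Var → ℤ → Set where
  vfr : ∀ j n → TyV ρ (fr j n) j
  vbv : ∀ m {ℓ} → ρ m ≡ ℓ → TyV ρ (bv m) ℓ

mutual
  data TyP (ρ : Ctx) : Pred → Set where
    tand : ∀ {xs} → All (TyP ρ) xs → TyP ρ (and xs)
    tneg : ∀ {X} → TyP ρ X → TyP ρ (neg X)
    tall : ∀ {k X} → TyP (k ∷c ρ) X → TyP ρ (all k X)
    telt : ∀ {z v i} → TyS ρ z i → TyV ρ v (sucℤ i) → TyP ρ (elt z v)

  data TyS (ρ : Ctx) : SetT → ℤ → Set where
    tatm : ∀ {v i} → TyV ρ v i → TyS ρ (atm v) i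
    tst  : ∀ {k X} → TyP (k ∷c ρ) X → TyS ρ (st k X) (sucℤ k)

sucℤ-injective : ∀ {i j} → sucℤ i ≡ sucℤ j → i ≡ j
sucℤ-injective {i} {j} e = trans (sym (ℤ.pred-suc i)) (trans (cong ℤ.pred e) (ℤ.pred-suc j))

-- The default context for closed terms (its values are never consulted).
ρ₀ : Ctx
ρ₀ _ = + 0

_++c_ : List ℤ → Ctx → Ctx
[] ++c ρ = ρ
(k ∷ Γ) ++c ρ = k ∷c (Γ ++c ρ)

∋⇒lookup : ∀ {Γ m j} ρ → Γ ∋ m ∶ j → (Γ ++c ρ) m ≡ j
∋⇒lookup ρ ze = refl
∋⇒lookup ρ (su p) = ∋⇒lookup ρ p

fromWTV : ∀ {Γ v i} ρ → WTV Γ v i → TyV (Γ ++c ρ) v i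
fromWTV ρ (fr j n) = vfr j n
fromWTV ρ (bv {m} p) = vbv m (∋⇒lookup ρ p)

mutual
  fromWTP : ∀ {Γ X} ρ → WTP Γ X → TyP (Γ ++c ρ) X
  fromWTP ρ (and ps) = tand (fromWTL ρ ps)
  fromWTP ρ (neg p) = tneg (fromWTP ρ p)
  fromWTP ρ (all p) = tall (fromWTP ρ p)
  fromWTP ρ (elt p q) = telt (fromWTS ρ p) (fromWTV ρ q)

  fromWTL : ∀ {Γ xs} ρ → All (WTP Γ) xs → All (TyP (Γ ++c ρ)) xs
  fromWTL ρ [] = []
  fromWTL ρ (p ∷ ps) = fromWTP ρ p ∷ fromWTL ρ ps

  fromWTS : ∀ {Γ x i} ρ → WTS Γ x i → TyS (Γ ++c ρ) x i
  fromWTS ρ (atm p) = tatm (fromWTV ρ p)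
  fromWTS ρ (st p refl) = tst (fromWTP ρ p)

Shifts : ℕ → Ctx → Ctx → Set
Shifts c ρ σ = ∀ m → σ (shiftIdx c m) ≡ ρ m

Shifts-∷ : ∀ {ρ σ c} k → Shifts c ρ σ → Shifts (suc c) (k ∷c ρ) (k ∷c σ)
Shifts-∷ k e zero = refl
Shifts-∷ k e (suc m) = e m

shiftTyV : ∀ {ρ σ c v ℓ} → Shifts c ρ σ → TyV ρ v ℓ → TyV σ (shiftV c v) ℓ
shiftTyV e (vfr j n) = vfr j n
shiftTyV {c = c} e (vbv m eq) rewrite shiftV-bv c m = vbv (shiftIdx c m) (trans (e m) eq)

mutual
  shiftTyP : ∀ {ρ σ c X} → Shifts c ρ σ → TyP ρ X → TyP σ (shiftP c X)
  shiftTyP e (tand ps) = tand (shiftTyL e ps)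
  shiftTyP e (tneg p) = tneg (shiftTyP e p)
  shiftTyP e (tall {k} p) = tall (shiftTyP (Shifts-∷ k e) p)
  shiftTyP e (telt p q) = telt (shiftTyS e p) (shiftTyV e q)

  shiftTyL : ∀ {ρ σ c xs} → Shifts c ρ σ → All (TyP ρ) xs → All (TyP σ) (shiftL c xs)
  shiftTyL e [] = []
  shiftTyL e (p ∷ ps) = shiftTyP e p ∷ shiftTyL e ps

  shiftTyS : ∀ {ρ σ c s i} → Shifts c ρ σ → TyS ρ s i → TyS σ (shiftS c s) i
  shiftTyS e (tatm q) = tatm (shiftTyV e q)
  shiftTyS e (tst {k} p) = tst (shiftTyP (Shifts-∷ k e) p)

shiftTyS₀ : ∀ {σ s i} k → TyS σ s i → TyS (k ∷c σ) (shiftS zero s) i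
shiftTyS₀ k = shiftTyS (λ m → refl)

-- TyTgt ρ t ℓ σ : the target t has level ℓ in ρ, and substituting for it
-- takes terms over ρ to terms over σ (for a bound index, σ is ρ without it).
data TyTgt (ρ : Ctx) : Tgt → ℤ → Ctx → Set where
  tgt-free  : ∀ {j n σ} → (∀ m → σ m ≡ ρ m) → TyTgt ρ (tfr j n) j σ
  tgt-bound : ∀ {k ℓ σ} → ρ k ≡ ℓ → (∀ m → σ m ≡ ρ (shiftIdx k m)) → TyTgt ρ (tbv k) ℓ σ

TyTgt-free : ∀ {ρ j n} → TyTgt ρ (tfr j n) j ρ
TyTgt-free = tgt-free (λ _ → refl)

TyTgt-zero : ∀ k σ → TyTgt (k ∷c σ) (tbv zero) k σ
TyTgt-zero k σ = tgt-bound refl (λ m → refl)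

TyTgt-up : ∀ {ρ t ℓ σ} k → TyTgt ρ t ℓ σ → TyTgt (k ∷c ρ) (up t) ℓ (k ∷c σ)
TyTgt-up k (tgt-free e) = tgt-free (λ { zero → refl ; (suc m) → e m })
TyTgt-up k (tgt-bound e₁ e₂) = tgt-bound e₁ (λ { zero → refl ; (suc m) → e₂ m })

LookTy : Ctx → ℤ → ℤ → Look → Set
LookTy σ ℓ ℓv hit = ℓv ≡ ℓ
LookTy σ ℓ ℓv (miss w) = TyV σ w ℓv

look-typed : ∀ {ρ t ℓ σ v ℓv} → TyTgt ρ t ℓ σ → TyV ρ v ℓv → LookTy σ ℓ ℓv (look t v)
look-typed {t = tfr j n} (tgt-free e) (vfr j' n') with freeLook j n j' n'
... | same refl refl rewrite look-free-self j n = refl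
... | other ne rewrite look-free-miss ne = vfr j' n'
look-typed (tgt-free e) (vbv m eq) = vbv m (trans (e m) eq)
look-typed (tgt-bound e₁ e₂) (vfr j n) = vfr j n
look-typed {t = tbv k} (tgt-bound e₁ e₂) (vbv m eq) with idxView k m
... | at-k rewrite lookBv-self k = trans (sym eq) e₁
... | off-k m' rewrite lookBv-shiftIdx k m' = vbv m' (trans (e₂ m') eq)

mutual
  substTyP : ∀ n {ρ t ℓ σ S X} → TyTgt ρ t ℓ σ → TyS σ S ℓ → TyP ρ X → TyP σ (subP n t S X)
  substTyP n tgt ts (tand ps) = tand (substTyL n tgt ts ps)
  substTyP n tgt ts (tneg p) = tneg (substTyP n tgt ts p)
  substTyP n tgt ts (tall {k} p) = tall (substTyP n (TyTgt-up k tgt) (shiftTyS₀ k ts) p)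
  substTyP n tgt ts (telt p q) = eltCaseTy n ts (substTyS n tgt ts p) (look-typed tgt q)

  substTyL : ∀ n {ρ t ℓ σ S xs} → TyTgt ρ t ℓ σ → TyS σ S ℓ → All (TyP ρ) xs → All (TyP σ) (subL n t S xs)
  substTyL n tgt ts [] = []
  substTyL n tgt ts (p ∷ ps) = substTyP n tgt ts p ∷ substTyL n tgt ts ps

  substTyS : ∀ n {ρ t ℓ σ S s i} → TyTgt ρ t ℓ σ → TyS σ S ℓ → TyS ρ s i → TyS σ (subS n t S s) i
  substTyS n {t = t} tgt ts (tatm {v} q) with look t v | look-typed tgt q
  ... | hit | refl = ts
  ... | miss w | q' = tatm q'
  substTyS n tgt ts (tst {k} p) = tst (substTyP n (TyTgt-up k tgt) (shiftTyS₀ k ts) p)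

  eltCaseTy : ∀ n {σ S ℓ z i L} → TyS σ S ℓ → TyS σ z i → LookTy σ ℓ (sucℤ i) L → TyP σ (eltCase n S z L)
  eltCaseTy n {L = miss w} ts tz q = telt tz q
  eltCaseTy n {L = hit} (tatm tv) tz refl = telt tz tv
  eltCaseTy zero {L = hit} (tst p) tz h = tand []
  eltCaseTy (suc n) {σ} {L = hit} (tst {k} p) tz h = substTyP n (TyTgt-zero k σ) (subst (TyS σ _) (sucℤ-injective h) tz) p

lv-shiftV : ∀ c v → lvV (shiftV c v) ≡ lvV v
lv-shiftV c (fr j n) = refl
lv-shiftV c (bv m) rewrite shiftV-bv c m = refl

mutual
  lv-shiftP : ∀ c X → lvP (shiftP c X) ≡ lvP X
  lv-shiftP c (and xs) = lv-shiftL c xs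
  lv-shiftP c (neg X) = lv-shiftP c X
  lv-shiftP c (all k X) = cong (∣ k ∣ ⊔_) (lv-shiftP (suc c) X)
  lv-shiftP c (elt y w) = cong₂ _⊔_ (lv-shiftS c y) (lv-shiftV c w)

  lv-shiftL : ∀ c xs → lvL (shiftL c xs) ≡ lvL xs
  lv-shiftL c [] = refl
  lv-shiftL c (X ∷ xs) = cong₂ _⊔_ (lv-shiftP c X) (lv-shiftL c xs)

  lv-shiftS : ∀ c s → lvS (shiftS c s) ≡ lvS s
  lv-shiftS c (atm w) = lv-shiftV c w
  lv-shiftS c (st k X) = cong (∣ k ∣ ⊔_) (lv-shiftP (suc c) X)

lv-shiftS≤ : ∀ {B} c s → lvS s ≤ B → lvS (shiftS c s) ≤ B
lv-shiftS≤ c s p rewrite lv-shiftS c s = p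

⊔≤⇒ˡ : ∀ {a b B} → a ⊔ b ≤ B → a ≤ B
⊔≤⇒ˡ {a} {b} = m⊔n≤o⇒m≤o a b

⊔≤⇒ʳ : ∀ {a b B} → a ⊔ b ≤ B → b ≤ B
⊔≤⇒ʳ {a} {b} = m⊔n≤o⇒n≤o a b

LookLv : ℕ → Look → Set
LookLv B hit = ⊤
LookLv B (miss w) = lvV w ≤ B

look-lv : ∀ {B} t v → lvV v ≤ B → LookLv B (look t v)
look-lv (tfr j n) (fr j' n') p with freeLook j n j' n'
... | same refl refl rewrite look-free-self j n = tt
... | other ne rewrite look-free-miss ne = p
look-lv (tfr j n) (bv m) p = z≤n
look-lv (tbv k) (fr j n) p = p
look-lv (tbv k) (bv m) p with idxView k m
... | at-k rewrite lookBv-self k = tt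
... | off-k m' rewrite lookBv-shiftIdx k m' = z≤n

mutual
  lv-substP : ∀ n {B} t S X → lvS S ≤ B → lvP X ≤ B → lvP (subP n t S X) ≤ B
  lv-substP n t S (and xs) lS lX = lv-substL n t S xs lS lX
  lv-substP n t S (neg X) lS lX = lv-substP n t S X lS lX
  lv-substP n t S (all k X) lS lX =
    ⊔-lub (⊔≤⇒ˡ lX) (lv-substP n (up t) (shiftS zero S) X (lv-shiftS≤ zero S lS) (⊔≤⇒ʳ {∣ k ∣} lX))
  lv-substP n t S (elt y w) lS lX =
    lv-eltCase n S (subS n t S y) (look t w) lS (lv-substS n t S y lS (⊔≤⇒ˡ lX)) (look-lv t w (⊔≤⇒ʳ {lvS y} lX))

  lv-substL : ∀ n {B} t S xs → lvS S ≤ B → lvL xs ≤ B → lvL (subL n t S xs) ≤ B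
  lv-substL n t S [] lS lX = z≤n
  lv-substL n t S (X ∷ xs) lS lX = ⊔-lub (lv-substP n t S X lS (⊔≤⇒ˡ lX)) (lv-substL n t S xs lS (⊔≤⇒ʳ {lvP X} lX))

  lv-substS : ∀ n {B} t S s → lvS S ≤ B → lvS s ≤ B → lvS (subS n t S s) ≤ B
  lv-substS n t S (atm w) lS lX with look t w | look-lv t w lX
  ... | hit | _ = lS
  ... | miss w' | lw = lw
  lv-substS n t S (st k X) lS lX =
    ⊔-lub (⊔≤⇒ˡ lX) (lv-substP n (up t) (shiftS zero S) X (lv-shiftS≤ zero S lS) (⊔≤⇒ʳ {∣ k ∣} lX))

  lv-eltCase : ∀ n {B} S z L → lvS S ≤ B → lvS z ≤ B → LookLv B L → lvP (eltCase n S z L) ≤ B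
  lv-eltCase n S z (miss w) lS lz lw = ⊔-lub lz lw
  lv-eltCase n (atm v) z hit lS lz _ = ⊔-lub lz lS
  lv-eltCase zero (st k X) z hit lS lz _ = z≤n
  lv-eltCase (suc n) (st k X) z hit lS lz _ = lv-substP n (tbv zero) z X lz (⊔≤⇒ʳ {∣ k ∣} lS)

-- Each beta-step lowers the level of the target by one,
-- and the levels it passes through stay above -B when B bounds all levels,
-- so from level ℓ at most ℓ + B + 1 nested beta-steps occur.

Enough : ℕ → ℤ → ℕ → Set
Enough B (+ m) n = m + B < n
Enough B (-[1+ m ]) n = B < n + suc m

enough-pred : ∀ {B k n} → Enough B (sucℤ k) (suc n) → Enough B k n
enough-pred {B} {+ m} (s≤s p) = p
enough-pred {B} { -[1+ zero ]} {n} p rewrite +-comm n 1 = p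
enough-pred {B} { -[1+ suc m ]} {n} p rewrite +-suc n (suc m) = p

enough-nonzero : ∀ {B k} → ∣ k ∣ ≤ B → ¬ Enough B (sucℤ k) zero
enough-nonzero {B} {+ m} _ ()
enough-nonzero {B} { -[1+ zero ]} _ ()
enough-nonzero {B} { -[1+ suc m ]} k≤B p = <-irrefl refl (≤-trans p (≤-trans (m≤n⇒m≤1+n ≤-refl) k≤B))

enough-fuel-mono : ∀ {B ℓ n p} → n ≤ p → Enough B ℓ n → Enough B ℓ p
enough-fuel-mono {B} {+ m} n≤p e = ≤-trans e n≤p
enough-fuel-mono {B} { -[1+ m ]} n≤p e = ≤-trans e (+-monoˡ-≤ (suc m) n≤p)

enough-bound-anti : ∀ {B B′ ℓ n} → B′ ≤ B → Enough B ℓ n → Enough B′ ℓ n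
enough-bound-anti {ℓ = + m} B′≤B e = ≤-trans (s≤s (+-monoʳ-≤ m B′≤B)) e
enough-bound-anti {ℓ = -[1+ m ]} B′≤B e = ≤-trans (s≤s B′≤B) e

enough-fuel : ∀ B j → Enough B j (fuel j B)
enough-fuel B (+ m) = ≤-refl
enough-fuel B (-[1+ m ]) = s≤s (≤-trans (m≤n+m B (suc m)) (m≤m+n _ _))

enough-fuel-pred : ∀ B {j} k → j ≡ sucℤ k → Enough B k (∣ j ∣ + B)
enough-fuel-pred B (+ m) refl = ≤-refl
enough-fuel-pred B (-[1+ zero ]) refl rewrite +-comm B 1 = ≤-refl
enough-fuel-pred B (-[1+ suc m ]) refl = s≤s (≤-trans (m≤n+m B m) (m≤m+n _ _))

record WellSubst (B : ℕ) (ρ : Ctx) (t : Tgt) (ℓ : ℤ) (σ : Ctx) (S : SetT) : Set where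
  constructor well
  field
    tgtTy : TyTgt ρ t ℓ σ
    setTy : TyS σ S ℓ
    setLv : lvS S ≤ B

WellSubst-up : ∀ {B ρ t ℓ σ S} k → WellSubst B ρ t ℓ σ S →
               WellSubst B (k ∷c ρ) (up t) ℓ (k ∷c σ) (shiftS zero S)
WellSubst-up {S = S} k (well tgt ts lS) = well (TyTgt-up k tgt) (shiftTyS₀ k ts) (lv-shiftS≤ zero S lS)

mutual
  fuel-monoP : ∀ {B n n′ ρ t ℓ σ S} → n ≤ n′ → WellSubst B ρ t ℓ σ S → Enough B ℓ n →
               ∀ {X} → TyP ρ X → lvP X ≤ B → subP n′ t S X ≡ subP n t S X
  fuel-monoP n≤n′ w e (tand ps) lX = cong and (fuel-monoL n≤n′ w e ps lX)
  fuel-monoP n≤n′ w e (tneg px) lX = cong neg (fuel-monoP n≤n′ w e px lX)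
  fuel-monoP n≤n′ w e (tall {k} px) lX = cong (all k) (fuel-monoP n≤n′ (WellSubst-up k w) e px (⊔≤⇒ʳ {∣ k ∣} lX))
  fuel-monoP {n = n} {t = t} {S = S} n≤n′ w@(well tgt ts lS) e (telt {z} {v} pz pv) lX
    rewrite fuel-monoS n≤n′ w e pz (⊔≤⇒ˡ lX) =
    eltCase-fuel-mono n≤n′ (look t v) ts lS e (substTyS n tgt ts pz)
      (lv-substS n t S z lS (⊔≤⇒ˡ lX)) (look-typed tgt pv)

  fuel-monoL : ∀ {B n n′ ρ t ℓ σ S} → n ≤ n′ → WellSubst B ρ t ℓ σ S → Enough B ℓ n →
               ∀ {xs} → All (TyP ρ) xs → lvL xs ≤ B → subL n′ t S xs ≡ subL n t S xs
  fuel-monoL n≤n′ w e [] lX = refl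
  fuel-monoL n≤n′ w e (_∷_ {X} px ps) lX =
    cong₂ _∷_ (fuel-monoP n≤n′ w e px (⊔≤⇒ˡ lX)) (fuel-monoL n≤n′ w e ps (⊔≤⇒ʳ {lvP X} lX))

  fuel-monoS : ∀ {B n n′ ρ t ℓ σ S} → n ≤ n′ → WellSubst B ρ t ℓ σ S → Enough B ℓ n →
               ∀ {s i} → TyS ρ s i → lvS s ≤ B → subS n′ t S s ≡ subS n t S s
  fuel-monoS {t = t} n≤n′ w e (tatm {v} pv) lX with look t v
  ... | hit = refl
  ... | miss _ = refl
  fuel-monoS n≤n′ w e (tst {k} px) lX = cong (st k) (fuel-monoP n≤n′ (WellSubst-up k w) e px (⊔≤⇒ʳ {∣ k ∣} lX))

  -- The beta-clause: the body of the substituted comprehension is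
  -- instantiated with one unit of fuel less, at the level below.
  eltCase-fuel-mono : ∀ {B n n′ σ S ℓ z i} → n ≤ n′ → ∀ L → TyS σ S ℓ → lvS S ≤ B → Enough B ℓ n →
                      TyS σ z i → lvS z ≤ B → LookTy σ ℓ (sucℤ i) L → eltCase n′ S z L ≡ eltCase n S z L
  eltCase-fuel-mono n≤n′ (miss w) ts lS e tz lz h = refl
  eltCase-fuel-mono n≤n′ hit (tatm tv) lS e tz lz h = refl
  eltCase-fuel-mono {n = zero} n≤n′ hit (tst {k} px) lS e tz lz h = ⊥-elim (enough-nonzero {k = k} (⊔≤⇒ˡ {∣ k ∣} lS) e)
  eltCase-fuel-mono {n = suc n} {suc n′} {σ} (s≤s n≤n′) hit (tst {k} px) lS e tz lz h =
    fuel-monoP n≤n′ (well (TyTgt-zero k σ) (subst (TyS σ _) (sucℤ-injective h) tz) lz) (enough-pred e)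
      px (⊔≤⇒ʳ {∣ k ∣} lS)

fuel-irrelevantP : ∀ {B n n′ ρ t ℓ σ S} → WellSubst B ρ t ℓ σ S → Enough B ℓ n → Enough B ℓ n′ →
                   ∀ {X} → TyP ρ X → lvP X ≤ B → subP n′ t S X ≡ subP n t S X
fuel-irrelevantP {n = n} {n′} w e e′ px lX with ≤-total n n′
... | inj₁ n≤n′ = fuel-monoP n≤n′ w e px lX
... | inj₂ n′≤n = sym (fuel-monoP n′≤n w e′ px lX)

fuel-irrelevantS : ∀ {B n n′ ρ t ℓ σ S} → WellSubst B ρ t ℓ σ S → Enough B ℓ n → Enough B ℓ n′ →
                   ∀ {s i} → TyS ρ s i → lvS s ≤ B → subS n′ t S s ≡ subS n t S s
fuel-irrelevantS {n = n} {n′} w e e′ ps lS with ≤-total n n′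
... | inj₁ n≤n′ = fuel-monoS n≤n′ w e ps lS
... | inj₂ n′≤n = sym (fuel-monoS n′≤n w e′ ps lS)

beta-fuel-irrelevant : ∀ {B n n′ σ S ℓ z i} → TyS σ S ℓ → lvS S ≤ B → Enough B ℓ n → Enough B ℓ n′ →
                       TyS σ z i → lvS z ≤ B → sucℤ i ≡ ℓ → eltCase n′ S z hit ≡ eltCase n S z hit
beta-fuel-irrelevant {n = n} {n′} ts lS e e′ tz lz h with ≤-total n n′
... | inj₁ n≤n′ = eltCase-fuel-mono n≤n′ hit ts lS e tz lz h
... | inj₂ n′≤n = sym (eltCase-fuel-mono n′≤n hit ts lS e′ tz lz h)

data CommTgt : Tgt → ℕ → Tgt → ℕ → Set where
  cm-free  : ∀ {j n c} → CommTgt (tfr j n) c (tfr j n) c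
  cm-below : ∀ {k d} → k ≤ d → CommTgt (tbv k) (suc d) (tbv k) d
  cm-above : ∀ {k c} → c ≤ k → CommTgt (tbv k) c (tbv (suc k)) c

CommTgt-up : ∀ {t₁ c₂ t₁′ c₂′} → CommTgt t₁ c₂ t₁′ c₂′ → CommTgt (up t₁) (suc c₂) (up t₁′) (suc c₂′)
CommTgt-up cm-free = cm-free
CommTgt-up (cm-below k≤d) = cm-below (s≤s k≤d)
CommTgt-up (cm-above c≤k) = cm-above (s≤s c≤k)

CommTgt-zero : ∀ t → CommTgt t zero (up t) zero
CommTgt-zero (tfr j n) = cm-free
CommTgt-zero (tbv k) = cm-above z≤n

commute-TyTgt : ∀ {t₁ c₂ t₁′ c₂′ ρ ρ₂ ρ₁₂ ℓ₁ ℓ₂} → CommTgt t₁ c₂ t₁′ c₂′ →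
                TyTgt ρ (tbv c₂) ℓ₂ ρ₂ → TyTgt ρ₂ t₁ ℓ₁ ρ₁₂ →
                Σ Ctx (λ ρ₁ → TyTgt ρ t₁′ ℓ₁ ρ₁ × TyTgt ρ₁ (tbv c₂′) ℓ₂ ρ₁₂)
commute-TyTgt {ρ = ρ} cm-free (tgt-bound e₁ e₂) (tgt-free f) =
  ρ , TyTgt-free , tgt-bound e₁ (λ m → trans (f m) (e₂ m))
commute-TyTgt {ρ = ρ} (cm-below {k} {d} k≤d) (tgt-bound e₁ e₂) (tgt-bound f₁ f₂) =
  (λ m → ρ (shiftIdx k m)) ,
  tgt-bound (trans (sym (cong ρ (shiftIdx-below (s≤s k≤d)))) (trans (sym (e₂ k)) f₁)) (λ m → refl) ,
  tgt-bound (trans (cong ρ (shiftIdx-above k≤d)) e₁)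
            (λ m → trans (f₂ m) (trans (e₂ (shiftIdx k m)) (cong ρ (shiftIdx-comm k≤d m))))
commute-TyTgt {ρ = ρ} (cm-above {k} {c} c≤k) (tgt-bound e₁ e₂) (tgt-bound f₁ f₂) =
  (λ m → ρ (shiftIdx (suc k) m)) ,
  tgt-bound (trans (sym (cong ρ (shiftIdx-above c≤k))) (trans (sym (e₂ k)) f₁)) (λ m → refl) ,
  tgt-bound (trans (cong ρ (shiftIdx-below (s≤s c≤k))) e₁)
            (λ m → trans (f₂ m) (trans (e₂ (shiftIdx k m)) (cong ρ (sym (shiftIdx-comm c≤k m)))))

look-comm-inner : ∀ {t₁ c₂ t₁′ c₂′} → CommTgt t₁ c₂ t₁′ c₂′ → look t₁′ (bv c₂) ≡ miss (bv c₂′)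
look-comm-inner cm-free = refl
look-comm-inner (cm-below {k} {d} k≤d) = subst (λ q → lookBv k q ≡ miss (bv d)) (shiftIdx-above k≤d) (lookBv-shiftIdx k d)
look-comm-inner (cm-above {k} {c} c≤k) =
  subst (λ q → lookBv (suc k) q ≡ miss (bv c)) (shiftIdx-below (s≤s c≤k)) (lookBv-shiftIdx (suc k) c)

-- A variable vs surviving the inner substitution (as v in the other order)
-- is hit by both outer targets or by neither, and then ends up the same.
data CommLook (t₁ t₁′ : Tgt) (c₂′ : ℕ) (vs v : Var) : Set where
  both-hit  : look t₁ vs ≡ hit → look t₁′ v ≡ hit → CommLook t₁ t₁′ c₂′ vs v
  both-miss : ∀ w w′ → look t₁ vs ≡ miss w′ → look t₁′ v ≡ miss w → look (tbv c₂′) w ≡ miss w′ →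
              CommLook t₁ t₁′ c₂′ vs v

commLook-bound : ∀ {t₁ c₂ t₁′ c₂′} → CommTgt t₁ c₂ t₁′ c₂′ →
                 ∀ m → CommLook t₁ t₁′ c₂′ (bv m) (bv (shiftIdx c₂ m))
commLook-bound (cm-free {c = c₂}) m = both-miss _ _ refl refl (lookBv-shiftIdx c₂ m)
commLook-bound (cm-below {k} {d} k≤d) m with idxView k m
... | at-k = both-hit (lookBv-self k)
                     (subst (λ q → lookBv k q ≡ hit) (sym (shiftIdx-below (s≤s k≤d))) (lookBv-self k))
... | off-k m′ = both-miss _ _ (lookBv-shiftIdx k m′)
  (subst (λ q → lookBv k q ≡ miss (bv (shiftIdx d m′))) (sym (shiftIdx-comm k≤d m′))
         (lookBv-shiftIdx k (shiftIdx d m′)))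
  (lookBv-shiftIdx d m′)
commLook-bound (cm-above {k} {c} c≤k) m with idxView k m
... | at-k = both-hit (lookBv-self k)
                     (subst (λ q → lookBv (suc k) q ≡ hit) (sym (shiftIdx-above c≤k)) (lookBv-self (suc k)))
... | off-k m′ = both-miss _ _ (lookBv-shiftIdx k m′)
  (subst (λ q → lookBv (suc k) q ≡ miss (bv (shiftIdx c m′))) (shiftIdx-comm c≤k m′)
         (lookBv-shiftIdx (suc k) (shiftIdx c m′)))
  (lookBv-shiftIdx c m′)

data InnerLook (c₂ : ℕ) (t₁ t₁′ : Tgt) (c₂′ : ℕ) : Var → Set where
  inner-hit  : InnerLook c₂ t₁ t₁′ c₂′ (bv c₂)
  inner-miss : ∀ {v} vs → look (tbv c₂) v ≡ miss vs → CommLook t₁ t₁′ c₂′ vs v → InnerLook c₂ t₁ t₁′ c₂′ v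

innerLook : ∀ {t₁ c₂ t₁′ c₂′} → CommTgt t₁ c₂ t₁′ c₂′ → ∀ v → InnerLook c₂ t₁ t₁′ c₂′ v
innerLook (cm-free {j₀} {n₀}) (fr j n) with freeLook j₀ n₀ j n
... | same refl refl = inner-miss _ refl (both-hit (look-free-self j₀ n₀) (look-free-self j₀ n₀))
... | other ne = inner-miss _ refl (both-miss _ _ (look-free-miss ne) (look-free-miss ne) refl)
innerLook (cm-below k≤d) (fr j n) = inner-miss _ refl (both-miss _ _ refl refl refl)
innerLook (cm-above c≤k) (fr j n) = inner-miss _ refl (both-miss _ _ refl refl refl)
innerLook {c₂ = c₂} cm (bv m) with idxView c₂ m
... | at-k = inner-hit
... | off-k m′ = inner-miss _ (lookBv-shiftIdx c₂ m′) (commLook-bound cm m′)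

private
  variable
    n₁ n₂ B c₂ c₂′ : ℕ
    t₁ t₁′ : Tgt
    S₁ S₂ : SetT
    ρ ρ₂ ρ₁₂ : Ctx
    ℓ₁ ℓ₂ : ℤ

-- Hypotheses of the substitution lemma: the inner substitution of S₂ for c₂
-- (ρ → ρ₂), the outer one of S₁ for t₁ (ρ₂ → ρ₁₂), enough fuel for both, and
-- a budget K bounding the total fuel, on which the lemma recurses.
record CommSetup (K n₁ n₂ B : ℕ) (t₁ : Tgt) (c₂ : ℕ) (t₁′ : Tgt) (c₂′ : ℕ)
                 (S₁ S₂ : SetT) (ρ ρ₂ ρ₁₂ : Ctx) (ℓ₁ ℓ₂ : ℤ) : Set where
  constructor setup
  field
    targets : CommTgt t₁ c₂ t₁′ c₂′
    inner   : WellSubst B ρ (tbv c₂) ℓ₂ ρ₂ S₂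
    outer   : WellSubst B ρ₂ t₁ ℓ₁ ρ₁₂ S₁
    enough₁ : Enough B ℓ₁ n₁
    enough₂ : Enough B ℓ₂ n₂
    budget  : n₁ + n₂ ≤ K

CommSetup-up : ∀ {K} k → CommSetup K n₁ n₂ B t₁ c₂ t₁′ c₂′ S₁ S₂ ρ ρ₂ ρ₁₂ ℓ₁ ℓ₂ →
               CommSetup K n₁ n₂ B (up t₁) (suc c₂) (up t₁′) (suc c₂′) (shiftS zero S₁) (shiftS zero S₂)
                         (k ∷c ρ) (k ∷c ρ₂) (k ∷c ρ₁₂) ℓ₁ ℓ₂
CommSetup-up k (setup cm w₂ w₁ e₁ e₂ bud) = setup (CommTgt-up cm) (WellSubst-up k w₂) (WellSubst-up k w₁) e₁ e₂ bud

mutual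
  subst-commP : ∀ K → CommSetup K n₁ n₂ B t₁ c₂ t₁′ c₂′ S₁ S₂ ρ ρ₂ ρ₁₂ ℓ₁ ℓ₂ →
                ∀ {X} → TyP ρ X → lvP X ≤ B →
                subP n₁ t₁ S₁ (subP n₂ (tbv c₂) S₂ X)
                  ≡ subP n₂ (tbv c₂′) (subS n₁ t₁ S₁ S₂) (subP n₁ t₁′ (shiftS c₂′ S₁) X)
  subst-commP K h (tand ps) lX = cong and (subst-commL K h ps lX)
  subst-commP K h (tneg px) lX = cong neg (subst-commP K h px lX)
  subst-commP K h (tall {k} px) lX = cong (all k) (subst-comm-under K h px (⊔≤⇒ʳ {∣ k ∣} lX))
  subst-commP K h (telt {z} {v} pz pv) lX = subst-comm-elt K h z v pz pv (⊔≤⇒ˡ lX) (subst-commS K h pz (⊔≤⇒ˡ lX))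

  subst-commL : ∀ K → CommSetup K n₁ n₂ B t₁ c₂ t₁′ c₂′ S₁ S₂ ρ ρ₂ ρ₁₂ ℓ₁ ℓ₂ →
                ∀ {xs} → All (TyP ρ) xs → lvL xs ≤ B →
                subL n₁ t₁ S₁ (subL n₂ (tbv c₂) S₂ xs)
                  ≡ subL n₂ (tbv c₂′) (subS n₁ t₁ S₁ S₂) (subL n₁ t₁′ (shiftS c₂′ S₁) xs)
  subst-commL K h [] lX = refl
  subst-commL K h (_∷_ {X} px ps) lX = cong₂ _∷_ (subst-commP K h px (⊔≤⇒ˡ lX)) (subst-commL K h ps (⊔≤⇒ʳ {lvP X} lX))

  subst-commS : ∀ K → CommSetup K n₁ n₂ B t₁ c₂ t₁′ c₂′ S₁ S₂ ρ ρ₂ ρ₁₂ ℓ₁ ℓ₂ →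
                ∀ {s i} → TyS ρ s i → lvS s ≤ B →
                subS n₁ t₁ S₁ (subS n₂ (tbv c₂) S₂ s)
                  ≡ subS n₂ (tbv c₂′) (subS n₁ t₁ S₁ S₂) (subS n₁ t₁′ (shiftS c₂′ S₁) s)
  subst-commS {n₁ = n₁} {n₂ = n₂} {t₁ = t₁} {c₂ = c₂} {c₂′ = c₂′} {S₁ = S₁} {S₂ = S₂} K h (tatm {v} _) lX
    with innerLook (CommSetup.targets h) v
  ... | inner-hit rewrite lookBv-self c₂ | look-comm-inner (CommSetup.targets h) | lookBv-self c₂′ = refl
  ... | inner-miss vs e (both-hit e₁ e₂) rewrite e | e₁ | e₂ = sym (subst-shiftedS n₂ c₂′ (subS n₁ t₁ S₁ S₂) S₁)
  ... | inner-miss vs e (both-miss w w′ e₁ e₂ e₃) rewrite e | e₁ | e₂ | e₃ = refl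
  subst-commS K h (tst {k} px) lX = cong (st k) (subst-comm-under K h px (⊔≤⇒ʳ {∣ k ∣} lX))

  subst-comm-under : ∀ K → CommSetup K n₁ n₂ B t₁ c₂ t₁′ c₂′ S₁ S₂ ρ ρ₂ ρ₁₂ ℓ₁ ℓ₂ →
                     ∀ {k X} → TyP (k ∷c ρ) X → lvP X ≤ B →
                     subP n₁ (up t₁) (shiftS zero S₁) (subP n₂ (tbv (suc c₂)) (shiftS zero S₂) X)
                       ≡ subP n₂ (tbv (suc c₂′)) (shiftS zero (subS n₁ t₁ S₁ S₂))
                              (subP n₁ (up t₁′) (shiftS zero (shiftS c₂′ S₁)) X)
  subst-comm-under {n₁ = n₁} {n₂ = n₂} {t₁ = t₁} {t₁′ = t₁′} {c₂′ = c₂′} {S₁ = S₁} {S₂ = S₂} K h {k} {X} px lX =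
    trans (subst-commP K (CommSetup-up k h) px lX)
          (cong₂ (λ S₂′ S₁′ → subP n₂ (tbv (suc c₂′)) S₂′ (subP n₁ (up t₁′) S₁′ X))
                 (sym (shift-substS (ShiftTgt-zero t₁) n₁ S₁ S₂)) (shiftS-comm₀ c₂′ S₁))

  subst-comm-elt : ∀ K → CommSetup K n₁ n₂ B t₁ c₂ t₁′ c₂′ S₁ S₂ ρ ρ₂ ρ₁₂ ℓ₁ ℓ₂ →
                   ∀ {i} z v → TyS ρ z i → TyV ρ v (sucℤ i) → lvS z ≤ B →
                   subS n₁ t₁ S₁ (subS n₂ (tbv c₂) S₂ z) ≡ subS n₂ (tbv c₂′) (subS n₁ t₁ S₁ S₂) (subS n₁ t₁′ (shiftS c₂′ S₁) z) →
                   subP n₁ t₁ S₁ (subP n₂ (tbv c₂) S₂ (elt z v))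
                     ≡ subP n₂ (tbv c₂′) (subS n₁ t₁ S₁ S₂) (subP n₁ t₁′ (shiftS c₂′ S₁) (elt z v))
  subst-comm-elt {n₂ = n₂} {c₂ = c₂} {c₂′ = c₂′} {S₂ = S₂} {ρ₂ = ρ₂} {ℓ₂ = ℓ₂} K h {i} z v pz pv lz IH
    with innerLook (CommSetup.targets h) v
  ... | inner-hit rewrite lookBv-self c₂ | look-comm-inner (CommSetup.targets h) | lookBv-self c₂′ | sym IH =
    subst-comm-inner-hit K h (subS n₂ (tbv c₂) S₂ z) (substTyS n₂ tgt₂ ts₂ pz)
      (subst (LookTy ρ₂ ℓ₂ (sucℤ i)) (lookBv-self c₂) (look-typed tgt₂ pv)) (lv-substS n₂ (tbv c₂) S₂ z l₂ lz)
    where open WellSubst (CommSetup.inner h) renaming (tgtTy to tgt₂; setTy to ts₂; setLv to l₂)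
  ... | inner-miss vs e cl rewrite e = subst-comm-outer K h z vs v pz pv lz cl IH

  -- The inner substitution fires on the element: its beta-step (if any) is
  -- commuted with the outer substitution by a recursive call.
  subst-comm-inner-hit : ∀ K → CommSetup K n₁ n₂ B t₁ c₂ t₁′ c₂′ S₁ S₂ ρ ρ₂ ρ₁₂ ℓ₁ ℓ₂ →
                         ∀ {i} z′ → TyS ρ₂ z′ i → sucℤ i ≡ ℓ₂ → lvS z′ ≤ B →
                         subP n₁ t₁ S₁ (eltCase n₂ S₂ z′ hit) ≡ eltCase n₂ (subS n₁ t₁ S₁ S₂) (subS n₁ t₁ S₁ z′) hit
  subst-comm-inner-hit {n₁ = n₁} {t₁ = t₁} {S₁ = S₁} K
    (setup cm (well tgt₂ (tatm {w} tw) l₂) (well tgt₁ ts₁ l₁) e₁ e₂ bud) z′ tz h lz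
    with look t₁ w | look-typed tgt₁ tw
  ... | miss w′ | _ = refl
  ... | hit | refl =
    beta-fuel-irrelevant ts₁ l₁ e₂ e₁ (substTyS n₁ tgt₁ ts₁ tz) (lv-substS n₁ t₁ S₁ z′ l₁ lz) h
  subst-comm-inner-hit {n₂ = zero} K (setup cm (well tgt₂ (tst py) l₂) w₁ e₁ e₂ bud) z′ tz h lz = refl
  subst-comm-inner-hit {n₁ = n₁} {n₂ = suc n₂} zero (setup cm (well tgt₂ (tst py) l₂) w₁ e₁ e₂ bud) z′ tz h lz
    with subst (_≤ zero) (+-suc n₁ n₂) bud
  ... | ()
  subst-comm-inner-hit {n₁ = n₁} {n₂ = suc n₂} {t₁ = t₁} {ρ₂ = ρ₂} (suc K)
    (setup cm (well tgt₂ (tst {k} py) l₂) w₁ e₁ e₂ bud) z′ tz h lz =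
    subst-commP K (setup (CommTgt-zero t₁) (well (TyTgt-zero k ρ₂) (subst (TyS ρ₂ z′) (sucℤ-injective h) tz) lz)
                         w₁ e₁ (enough-pred e₂) (s≤s⁻¹ (subst (_≤ suc K) (+-suc n₁ n₂) bud)))
      py (⊔≤⇒ʳ {∣ k ∣} l₂)

  subst-comm-outer : ∀ K → CommSetup K n₁ n₂ B t₁ c₂ t₁′ c₂′ S₁ S₂ ρ ρ₂ ρ₁₂ ℓ₁ ℓ₂ →
                     ∀ {i} z vs v → TyS ρ z i → TyV ρ v (sucℤ i) → lvS z ≤ B → CommLook t₁ t₁′ c₂′ vs v →
                     subS n₁ t₁ S₁ (subS n₂ (tbv c₂) S₂ z) ≡ subS n₂ (tbv c₂′) (subS n₁ t₁ S₁ S₂) (subS n₁ t₁′ (shiftS c₂′ S₁) z) →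
                     eltCase n₁ S₁ (subS n₁ t₁ S₁ (subS n₂ (tbv c₂) S₂ z)) (look t₁ vs)
                       ≡ subP n₂ (tbv c₂′) (subS n₁ t₁ S₁ S₂)
                              (eltCase n₁ (shiftS c₂′ S₁) (subS n₁ t₁′ (shiftS c₂′ S₁) z) (look t₁′ v))
  subst-comm-outer K h z vs v pz pv lz (both-miss w w′ e₁ e₂ e₃) IH rewrite e₁ | e₂ | e₃ | IH = refl
  subst-comm-outer {c₂′ = c₂′} K (setup cm w₂ (well tgt₁ (tatm {w₁} tw₁) l₁) e₁ e₂ bud) z vs v pz pv lz (both-hit h₁ h₂) IH
    rewrite h₁ | h₂ | look-shifted c₂′ w₁ | IH = refl
  subst-comm-outer {n₁ = zero} K (setup cm w₂ (well tgt₁ (tst px) l₁) e₁ e₂ bud) z vs v pz pv lz (both-hit h₁ h₂) IH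
    rewrite h₁ | h₂ = refl
  subst-comm-outer {n₁ = suc n₁} zero (setup cm w₂ (well tgt₁ (tst px) l₁) e₁ e₂ ()) z vs v pz pv lz (both-hit h₁ h₂) IH
  subst-comm-outer {n₁ = suc n₁} (suc K) h@(setup cm w₂ (well tgt₁ (tst {k} {U} px) l₁) e₁ e₂ bud)
    z vs v pz pv lz (both-hit h₁ h₂) IH
    rewrite h₁ | h₂ = trans (cong (λ Z → subP n₁ (tbv zero) Z U) IH) (subst-comm-beta K h z v pz pv lz h₂)

  -- The outer substitution fires a beta-step: the body U, instantiated at
  -- the element, is commuted past the inner substitution by a recursive call
  -- with one unit of fuel less.
  subst-comm-beta : ∀ K {k U} → CommSetup (suc K) (suc n₁) n₂ B t₁ c₂ t₁′ c₂′ (st k U) S₂ ρ ρ₂ ρ₁₂ ℓ₁ ℓ₂ →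
                    ∀ {i} z v → TyS ρ z i → TyV ρ v (sucℤ i) → lvS z ≤ B → look t₁′ v ≡ hit →
                    subP n₁ (tbv zero)
                         (subS n₂ (tbv c₂′) (subS (suc n₁) t₁ (st k U) S₂) (subS (suc n₁) t₁′ (shiftS c₂′ (st k U)) z)) U
                      ≡ subP n₂ (tbv c₂′) (subS (suc n₁) t₁ (st k U) S₂)
                             (subP n₁ (tbv zero) (subS (suc n₁) t₁′ (shiftS c₂′ (st k U)) z) (shiftP (suc c₂′) U))
  subst-comm-beta {n₁ = n₁} {n₂ = n₂} {B = B} {t₁ = t₁} {t₁′ = t₁′} {c₂′ = c₂′} {S₂ = S₂} {ρ₁₂ = ρ₁₂} {ℓ₂ = ℓ₂}
                  K {k} {U}
    (setup cm (well tgt₂ ts₂ l₂) (well tgt₁ (tst pU) l₁) e₁ e₂ bud) {i} z v pz pv lz hit′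
    with commute-TyTgt cm tgt₂ tgt₁
  ... | ρ₁ , tgt₁′ , tgt-bound f₁ f₂ =
    begin
      subP n₁ (tbv zero) W U
    ≡⟨ cong (subP n₁ (tbv zero) W) (sym (subst-shiftedP n₂ (suc c₂′) (shiftS zero S₂′) U)) ⟩
      subP n₁ (tbv zero) W (subP n₂ (tbv (suc c₂′)) (shiftS zero S₂′) (shiftP (suc c₂′) U))
    ≡⟨ sym (subst-commP K inst (shiftTyP (Shifts-∷ k shifts) pU) lU↑) ⟩
      subP n₂ (tbv c₂′) S₂′ (subP n₁ (tbv zero) zr (shiftP (suc c₂′) U))
    ∎
    where
    S₂′ = subS (suc n₁) t₁ (st k U) S₂
    S₁↑ = shiftS c₂′ (st k U)
    zr = subS (suc n₁) t₁′ S₁↑ z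
    W = subS n₂ (tbv c₂′) S₂′ zr
    shifts : Shifts c₂′ ρ₁₂ ρ₁
    shifts m = sym (f₂ m)
    lS₁↑ : lvS S₁↑ ≤ B
    lS₁↑ = lv-shiftS≤ c₂′ (st k U) l₁
    lU↑ : lvP (shiftP (suc c₂′) U) ≤ B
    lU↑ rewrite lv-shiftP (suc c₂′) U = ⊔≤⇒ʳ {∣ k ∣} l₁
    i≡k : i ≡ k
    i≡k = sucℤ-injective (subst (LookTy ρ₁ (sucℤ k) (sucℤ i)) hit′ (look-typed tgt₁′ pv))
    tzr : TyS ρ₁ zr k
    tzr = subst (TyS ρ₁ zr) i≡k (substTyS (suc n₁) tgt₁′ (shiftTyS shifts (tst pU)) pz)
    inst : CommSetup K n₂ n₁ B (tbv c₂′) zero (tbv (suc c₂′)) zero S₂′ zr (k ∷c ρ₁) ρ₁ ρ₁₂ ℓ₂ k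
    inst = setup (cm-above z≤n) (well (TyTgt-zero k ρ₁) tzr (lv-substS (suc n₁) t₁′ S₁↑ z lS₁↑ lz))
                 (well (tgt-bound f₁ f₂) (substTyS (suc n₁) tgt₁ (tst pU) ts₂) (lv-substS (suc n₁) t₁ (st k U) S₂ l₁ l₂))
                 e₂ (enough-pred e₁) (subst (_≤ K) (+-comm n₁ n₂) (s≤s⁻¹ bud))

σS-fuel : ∀ {B N ρ i j} n u y → TyS ρ u j → lvS u ≤ B → Enough B j N → TyS ρ y i → lvS y ≤ B →
          subS N (tfr j n) u y ≡ y [ (j , n) ↦ u ]S
σS-fuel {B} {j = j} n u y tu lu e ty ly =
  fuel-irrelevantS (well TyTgt-free tu (m≤n⊔m (lvS y) (lvS u)))
    (enough-fuel _ j) (enough-bound-anti (⊔-lub ly lu) e) ty (m≤m⊔n (lvS y) (lvS u))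

σP-fuel : ∀ {B N ρ j} n u X → TyS ρ u j → lvS u ≤ B → Enough B j N → TyP ρ X → lvP X ≤ B →
          subP N (tfr j n) u X ≡ X [ (j , n) ↦ u ]P
σP-fuel {B} {j = j} n u X tu lu e tX lX =
  fuel-irrelevantP (well TyTgt-free tu (m≤n⊔m (lvP X) (lvS u)))
    (enough-fuel _ j) (enough-bound-anti (⊔-lub lX lu) e) tX (m≤m⊔n (lvP X) (lvS u))

∈̃-unfold : ∀ {B N ρ k} X y → TyP (k ∷c ρ) X → lvS (st k X) ≤ B → TyS ρ y k → lvS y ≤ B → Enough B k N →
           y ∈̃ st k X ≡ subP N (tbv zero) y X
∈̃-unfold {B} {N} {ρ} {k} X y tX lX ty ly e =
  begin
    subP (fuel k Bc) (tfr k c) y Xc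
  ≡⟨ fuel-irrelevantP (well TyTgt-free ty (m≤n⊔m (lvP Xc) (lvS y)))
       (enough-bound-anti (⊔-lub lXc ly) e) (enough-fuel Bc k) tXc (m≤m⊔n (lvP Xc) (lvS y)) ⟩
    subP N (tfr k c) y Xc
  ≡⟨ subst-renameP N zero zero k c y X (s≤s (m≤m⊔n (nmP X) (nmS y))) ⟩
    subP N (tbv zero) y X
  ∎
  where
  c = suc (nmP X ⊔ nmS y)
  Xc = st k X at (k , c)
  Bc = lvP Xc ⊔ lvS y
  tXc : TyP ρ Xc
  tXc = substTyP zero (TyTgt-zero k ρ) (tatm (vfr k c)) tX
  lXc : lvP Xc ≤ B
  lXc = lv-substP zero (tbv zero) (atm (fr k c)) X (⊔≤⇒ˡ lX) (⊔≤⇒ʳ {∣ k ∣} lX)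

tyClosed : ∀ {x i} → WTS [] x i → TyS ρ₀ x i
tyClosed = fromWTS ρ₀

∈̃ₐ-subst-other : ∀ {i} j n u y b → WTS [] y i → WTS [] u j → b ≢ (j , n) →
                 (y ∈̃ₐ b) [ (j , n) ↦ u ]P ≈P ((y [ (j , n) ↦ u ]S) ∈̃ₐ b)
∈̃ₐ-subst-other j n u y (l , m) wy wu b≢a =
  ≡⇒≈P (begin
    eltCase F u (subS F (tfr j n) u y) (look (tfr j n) (fr l m))
  ≡⟨ cong (eltCase F u (subS F (tfr j n) u y)) (look-free-miss (λ e → b≢a (sym e))) ⟩
    elt (subS F (tfr j n) u y) (fr l m)
  ≡⟨ cong (λ y′ → elt y′ (fr l m)) (σS-fuel n u y (tyClosed wu) (m≤n⊔m _ (lvS u)) (enough-fuel _ j)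
                                      (tyClosed wy) (⊔≤⇒ˡ (m≤m⊔n (lvS y ⊔ ∣ l ∣) (lvS u)))) ⟩
    elt (y [ (j , n) ↦ u ]S) (fr l m)
  ∎)
  where
  F = fuel j (lvP (elt y (fr l m)) ⊔ lvS u)

-- Part (2): substitution for a itself turns y ∈̃ a into membership in u; for
-- a comprehension u this is the beta-clause.
∈̃ₐ-subst-self : ∀ {i} j n u y → WTS [] y i → WTS [] u j → j ≡ sucℤ i →
                (y ∈̃ₐ (j , n)) [ (j , n) ↦ u ]P ≈P ((y [ (j , n) ↦ u ]S) ∈̃ u)
∈̃ₐ-subst-self j n u y wy wu j≡1+i = ≡⇒≈P (trans (cong (eltCase F u y′F) (look-free-self j n)) (beta u wu lu))
  where
  Bnd = lvP (elt y (fr j n)) ⊔ lvS u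
  F = fuel j Bnd
  lu : lvS u ≤ Bnd
  lu = m≤n⊔m _ (lvS u)
  ly : lvS y ≤ Bnd
  ly = ⊔≤⇒ˡ (m≤m⊔n (lvS y ⊔ ∣ j ∣) (lvS u))
  y′F = subS F (tfr j n) u y
  y′ = y [ (j , n) ↦ u ]S
  y′F≡y′ : y′F ≡ y′
  y′F≡y′ = σS-fuel n u y (tyClosed wu) lu (enough-fuel Bnd j) (tyClosed wy) ly
  beta : ∀ v → WTS [] v j → lvS v ≤ Bnd → eltCase F v y′F hit ≡ y′ ∈̃ v
  beta (atm (fr .j m)) (atm (fr .j .m)) _ = cong (λ z → elt z (fr j m)) y′F≡y′
  beta (st k U) (st pU j≡1+k) lU =
    begin
      subP (∣ j ∣ + Bnd) (tbv zero) y′F U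
    ≡⟨ cong (λ z → subP (∣ j ∣ + Bnd) (tbv zero) z U) y′F≡y′ ⟩
      subP (∣ j ∣ + Bnd) (tbv zero) y′ U
    ≡⟨ sym (∈̃-unfold U y′ (fromWTP ρ₀ pU) lU ty′ (lv-substS _ (tfr j n) u y lu ly)
                      (enough-fuel-pred Bnd k j≡1+k)) ⟩
      y′ ∈̃ st k U
    ∎
    where
    ty′ : TyS ρ₀ y′ k
    ty′ = subst (TyS ρ₀ y′) (sucℤ-injective (trans (sym j≡1+i) j≡1+k))
                (substTyS _ TyTgt-free (tyClosed wu) (tyClosed wy))

atm-subst-hit : ∀ N t S w → look t w ≡ hit → subS N t S (atm w) ≡ S
atm-subst-hit N t S w e rewrite e = refl

atm-subst-miss : ∀ N t S w {w′} → look t w ≡ miss w′ → subS N t S (atm w) ≡ atm w′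
atm-subst-miss N t S w e rewrite e = refl

≈P-∈̃-set : ∀ {P y x x′} → x ≡ x′ → P ≈P (y ∈̃ x) → P ≈P (y ∈̃ x′)
≈P-∈̃-set refl p = p

-- Part (1) for a set atom x: either x is the atom a (part 2) or not (part 3).
∈̃-subst-atom : ∀ i j n l m y u → WTS [] (atm (fr l m)) (sucℤ i) → WTS [] y i → WTS [] u j →
               (y ∈̃ atm (fr l m)) [ (j , n) ↦ u ]P ≈P ((y [ (j , n) ↦ u ]S) ∈̃ (atm (fr l m) [ (j , n) ↦ u ]S))
∈̃-subst-atom i j n l m y u (atm (fr .l .m)) wy wu with freeLook j n l m
... | same refl refl =
  ≈P-∈̃-set (sym (atm-subst-hit (fuel j (∣ j ∣ ⊔ lvS u)) (tfr j n) u (fr j n) (look-free-self j n)))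
           (∈̃ₐ-subst-self j n u y wy wu refl)
... | other ne =
  ≈P-∈̃-set (sym (atm-subst-miss (fuel j (∣ l ∣ ⊔ lvS u)) (tfr j n) u (fr l m) (look-free-miss ne)))
           (∈̃ₐ-subst-other j n u y (l , m) wy wu (λ e → ne (sym e)))

-- Part (1) for a comprehension x = st([c]X): unfold both memberships to
-- substitutions for the bound index and apply the substitution lemma.
∈̃-subst-st : ∀ i j n k X y u → WTS [] (st k X) (sucℤ i) → WTS [] y i → WTS [] u j →
             (y ∈̃ st k X) [ (j , n) ↦ u ]P ≈P ((y [ (j , n) ↦ u ]S) ∈̃ (st k X [ (j , n) ↦ u ]S))
∈̃-subst-st i j n k X y u (st pX 1+i≡1+k) wy wu = ≡⇒≈P
  (begin
    (y ∈̃ st k X) [ (j , n) ↦ u ]P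
  ≡⟨ cong (_[ (j , n) ↦ u ]P) (∈̃-unfold X y tX lx ty ly (enough-fuel Bnd k)) ⟩
    (subP N₂ (tbv zero) y X) [ (j , n) ↦ u ]P
  ≡⟨ sym (σP-fuel n u _ tu lu (enough-fuel Bnd j) (substTyP N₂ (TyTgt-zero k ρ₀) ty tX)
                  (lv-substP N₂ (tbv zero) y X ly lX)) ⟩
    subP N₁ (tfr j n) u (subP N₂ (tbv zero) y X)
  ≡⟨ subst-commP (N₁ + N₂) (setup cm-free (well (TyTgt-zero k ρ₀) ty ly) (well TyTgt-free tu lu)
                                  (enough-fuel Bnd j) (enough-fuel Bnd k) ≤-refl) tX lX ⟩
    subP N₂ (tbv zero) (subS N₁ (tfr j n) u y) (subP N₁ (tfr j n) (shiftS zero u) X)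
  ≡⟨ cong₂ (subP N₂ (tbv zero)) (σS-fuel n u y tu lu (enough-fuel Bnd j) ty ly) X-fuel ⟩
    subP N₂ (tbv zero) y′ X′
  ≡⟨ sym (∈̃-unfold X′ y′ tX′ lx′ ty′ ly′ (enough-fuel Bnd k)) ⟩
    y′ ∈̃ st k X′
  ∎)
  where
  Bnd = (lvS (st k X) ⊔ lvS y) ⊔ lvS u
  B₂ = lvS (st k X) ⊔ lvS u
  N₁ = fuel j Bnd
  N₂ = fuel k Bnd
  y′ = y [ (j , n) ↦ u ]S
  X′ = subP (fuel j B₂) (tfr j n) (shiftS zero u) X
  tu = tyClosed wu
  tX : TyP (k ∷c ρ₀) X
  tX = fromWTP ρ₀ pX
  ty : TyS ρ₀ y k
  ty = subst (TyS ρ₀ y) (sucℤ-injective 1+i≡1+k) (tyClosed wy)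
  lx : lvS (st k X) ≤ Bnd
  lx = ⊔≤⇒ˡ (m≤m⊔n (lvS (st k X) ⊔ lvS y) (lvS u))
  lX : lvP X ≤ Bnd
  lX = ⊔≤⇒ʳ {∣ k ∣} lx
  ly : lvS y ≤ Bnd
  ly = ⊔≤⇒ʳ {lvS (st k X)} (m≤m⊔n (lvS (st k X) ⊔ lvS y) (lvS u))
  lu : lvS u ≤ Bnd
  lu = m≤n⊔m (lvS (st k X) ⊔ lvS y) (lvS u)
  X-fuel : subP N₁ (tfr j n) (shiftS zero u) X ≡ X′
  X-fuel = fuel-irrelevantP (well TyTgt-free (shiftTyS₀ k tu) (lv-shiftS≤ zero u (m≤n⊔m (lvS (st k X)) (lvS u))))
             (enough-fuel B₂ j) (enough-bound-anti (⊔-lub lx lu) (enough-fuel Bnd j))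
             tX (⊔≤⇒ʳ {∣ k ∣} (m≤m⊔n (lvS (st k X)) (lvS u)))
  tX′ : TyP (k ∷c ρ₀) X′
  tX′ = substTyP _ TyTgt-free (shiftTyS₀ k tu) tX
  lx′ : lvS (st k X′) ≤ Bnd
  lx′ = ⊔-lub (⊔≤⇒ˡ lx) (lv-substP _ (tfr j n) (shiftS zero u) X (lv-shiftS≤ zero u lu) lX)
  ty′ : TyS ρ₀ y′ k
  ty′ = substTyS _ TyTgt-free tu ty
  ly′ : lvS y′ ≤ Bnd
  ly′ = lv-substS _ (tfr j n) u y lu ly

∈̃-subst : ∀ i j n x y u → WTS [] x (sucℤ i) → WTS [] y i → WTS [] u j →
          (y ∈̃ x) [ (j , n) ↦ u ]P ≈P ((y [ (j , n) ↦ u ]S) ∈̃ (x [ (j , n) ↦ u ]S))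
∈̃-subst i j n (atm (fr l m)) y u wx wy wu = ∈̃-subst-atom i j n l m y u wx wy wu
∈̃-subst i j n (atm (bv m)) y u (atm (bv ())) wy wu
∈̃-subst i j n (st k X) y u wx wy wu = ∈̃-subst-st i j n k X y u wx wy wu

lemma4p26 : (i j : ℤ) (x y u : SetT) (n : ℕ) →
    WTS [] x (sucℤ i) → WTS [] y i → WTS [] u j →
    ((y ∈̃ x) [ (j , n) ↦ u ]P ≈P ((y [ (j , n) ↦ u ]S) ∈̃ (x [ (j , n) ↦ u ]S)))
    × (j ≡ sucℤ i → (y ∈̃ₐ (j , n)) [ (j , n) ↦ u ]P ≈P ((y [ (j , n) ↦ u ]S) ∈̃ u))
    × ((b : Atom) → Data.Product.proj₁ b ≡ sucℤ i → b ≢ (j , n) →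
    (y ∈̃ₐ b) [ (j , n) ↦ u ]P ≈P ((y [ (j , n) ↦ u ]S) ∈̃ₐ b))
lemma4p26 i j x y u n wx wy wu =
  ∈̃-subst i j n x y u wx wy wu ,
  ∈̃ₐ-subst-self j n u y wy wu ,
  λ b _ b≢a → ∈̃ₐ-subst-other j n u y b wy wu b≢a
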